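{- Let $L=(S,A,\to)$ be a labelled transition system and $x,y\in\{o,b\}$. Then $\underline{\leftrightarrow}^{ed}_{(x,y)}$ satisfies the stuttering property: whenever $t_0\xrightarrow{\tau}t_1\xrightarrow{\tau}\cdots\xrightarrow{\tau}t_k$ with $t_0\,\underline{\leftrightarrow}^{ed}_{(x,y)}\,t_k$, then $t_i\,\underline{\leftrightarrow}^{ed}_{(x,y)}\,t_j$ for all $0\le i,j\le k$.
   Context: LTS $L=(S,A,\to)$: states $S$, actions $A$ containing the internal action $\tau$, $\to\subseteq S\times A\times S$ written $s\xrightarrow{a}t$; $\twoheadrightarrow$ (resp. $\twoheadrightarrow^+$) is the reflexive-transitive (resp. transitive) closure of $\xrightarrow{\tau}$. For $R\subseteq S\times S$ and $s,s',t\in S$: $s\twoheadrightarrow_{o,R,t}s'$ iff $s\twoheadrightarrow s'$; $s\twoheadrightarrow_{b,R,t}s'$ iff $s\twoheadrightarrow s'$, $t\,R\,s$ and $t\,R\,s'$. For $x,y\in\{o,b\}$ a symmetric $R$ is an $(x,y)$-generic bisimulation if whenever $s\,R\,t$ and $s\xrightarrow{a}s'$, either $a=\tau$ and $s'\,R\,t$, or there exist $t_1,t_2,t'$ with $t\twoheadrightarrow_{x,R,s}t_1\xrightarrow{a}t_2\twoheadrightarrow_{y,R,s'}t'$ and $s'\,R\,t'$. $R$ is an $(x,y)$-generic bisimulation with explicit divergence if it is an $(x,y)$-generic bisimulation and for all $s\,R\,t$, whenever there is an infinite sequence $s=s_0\xrightarrow{\tau}s_1\xrightarrow{\tau}s_2\cdots$,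 there is $t'$ with $t\twoheadrightarrow^+t'$ and $s_k\,R\,t'$ for some $k$. $s\,\underline{\leftrightarrow}^{ed}_{(x,y)}\,t$ iff such a relation relates $s$ and $t$. -}

module Defs where

open import Level using (Level; suc; _⊔_)
open import Data.Nat using (ℕ) renaming (suc to sucℕ)
open import Data.Product using (Σ; ∃; ∃-syntax; _×_; _,_)
open import Data.Sum using (_⊎_)
open import Relation.Binary.PropositionalEquality using (_≡_)
open import Relation.Binary.Core using (Rel)
open import Relation.Binary.Definitions using (Symmetric)
open import Relation.Binary.Construct.Closure.ReflexiveTransitive using (Star)
open import Relation.Binary.Construct.Closure.Transitive using (TransClosure)

data Mode : Set where
  o b : Mode

record LTS : Set₁ where
  field
    S    : Set
    A    : Set
    τ    : A
    _⟶[_]_ : S → A → S → Set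

module _ (L : LTS) where
  open LTS L

  τStep : S → S → Set
  τStep s t = s ⟶[ τ ] t

  _↠_ : S → S → Set
  _↠_ = Star τStep

  _↠⁺_ : S → S → Set
  _↠⁺_ = TransClosure τStep

  modalSteps : Mode → Rel S _ → S → S → S → Set
  modalSteps o R t s s' = s ↠ s'
  modalSteps b R t s s' = (s ↠ s') × R t s × R t s'

  IsGenericBisim : Mode → Mode → Rel S _ → Set
  IsGenericBisim x y R =
    Symmetric R ×
    (∀ {s t s' a} → R s t → s ⟶[ a ] s' →
       (a ≡ τ × R s' t)
       ⊎ (∃[ t₁ ] ∃[ t₂ ] ∃[ t' ]
            (modalSteps x R s t t₁ × t₁ ⟶[ a ] t₂ × modalSteps y R s' t₂ t' × R s' t')))

  ExplicitDivergence : Rel S _ → Set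
  ExplicitDivergence R =
    ∀ {s t} → R s t → (σ : ℕ → S) → σ 0 ≡ s → (∀ n → τStep (σ n) (σ (sucℕ n))) →
      ∃[ t' ] ((t ↠⁺ t') × ∃[ k ] R (σ k) t')

  IsGenericBisimED : Mode → Mode → Rel S _ → Set
  IsGenericBisimED x y R = IsGenericBisim x y R × ExplicitDivergence R

  BisimED : Mode → Mode → S → S → Set₁
  BisimED x y s t = ∃[ R ] (IsGenericBisimED x y R × R s t)

module Submission where

-- Let R witness t₀ ↔ t_k.  Every state q on the τ-path is bracketed by an
-- R-pair: t₀ ↠ q ↠ t_k, and simulating t₀ ↠ p from t_k yields t_k ↠ w with
-- p R w.  So for p ↠ q on the path we have p ↠ q ↠ w with p R w.  Closing R
-- under such "bracketed" pairs (both directions) and the identity gives again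
-- an (x,y)-generic bisimulation with explicit divergence: a move of p that R
-- lets w answer is answered from q by first running q ↠ w, and a move of q is
-- answered by p running p ↠ q first.

open import Defs hiding (_↠_)
open import Level using (Level; 0ℓ)
open import Data.Nat using (ℕ; suc; z≤n; s≤s)
open import Data.Fin using (Fin; inject₁; fromℕ; _≤_) renaming (suc to fsuc; zero to fzero)
open import Data.Fin.Properties using (≤fromℕ; ≤-total)
open import Data.Product using (_×_; _,_; proj₁; proj₂; ∃-syntax)
open import Data.Sum using (_⊎_; inj₁; inj₂)
open import Function using (_∘_)
open import Relation.Binary.Core using (Rel)
open import Relation.Binary.PropositionalEquality using (_≡_; refl)
open import Relation.Binary.Construct.Closure.ReflexiveTransitive using (Star; ε; _◅_; _◅◅_)
open import Relation.Binary.Construct.Closure.Transitive using (TransClosure; [_]; _∷_)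

module _ {a ℓ : Level} {A : Set a} {_∼_ : Rel A ℓ} where

  ◅⁺ : ∀ {u v w} → u ∼ v → Star _∼_ v w → TransClosure _∼_ u w
  ◅⁺ u∼v ε           = [ u∼v ]
  ◅⁺ u∼v (v∼v′ ◅ vw) = u∼v ∷ ◅⁺ v∼v′ vw

  ◅◅⁺ : ∀ {u v w} → Star _∼_ u v → TransClosure _∼_ v w → TransClosure _∼_ u w
  ◅◅⁺ ε          vw = vw
  ◅◅⁺ (u∼ ◅ uv) vw = u∼ ∷ ◅◅⁺ uv vw

  ◅-unsnoc : ∀ {u v w} → u ∼ v → Star _∼_ v w → ∃[ w₀ ] (Star _∼_ u w₀ × w₀ ∼ w)
  ◅-unsnoc u∼v ε = _ , ε , u∼v
  ◅-unsnoc u∼v (v∼v′ ◅ vw) with ◅-unsnoc v∼v′ vw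
  ... | w₀ , v′w₀ , w₀∼w = w₀ , u∼v ◅ v′w₀ , w₀∼w

  chain⇒Star : ∀ {k} (t : Fin (suc k) → A) → (∀ i → t (inject₁ i) ∼ t (fsuc i)) →
               ∀ {i j} → i ≤ j → Star _∼_ (t i) (t j)
  chain⇒Star         t steps {fzero}  {fzero}  _         = ε
  chain⇒Star {suc k} t steps {fzero}  {fsuc j} _         =
    steps fzero ◅ chain⇒Star (t ∘ fsuc) (steps ∘ fsuc) {fzero} {j} z≤n
  chain⇒Star {suc k} t steps {fsuc i} {fsuc j} (s≤s i≤j) = chain⇒Star (t ∘ fsuc) (steps ∘ fsuc) i≤j

module _ (L : LTS) where
  open LTS L

  private
    _↠_ = Defs._↠_ L

  modalSteps⇒↠ : ∀ m {R : Rel S 0ℓ} {s t t′} → modalSteps L m R s t t′ → t ↠ t′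
  modalSteps⇒↠ o tt′       = tt′
  modalSteps⇒↠ b (tt′ , _) = tt′

  modalSteps-map : ∀ m {R Q : Rel S 0ℓ} → (∀ {u v} → R u v → Q u v) →
                   ∀ {s t t′} → modalSteps L m R s t t′ → modalSteps L m Q s t t′
  modalSteps-map o R⇒Q tt′              = tt′
  modalSteps-map b R⇒Q (tt′ , st , st′) = tt′ , R⇒Q st , R⇒Q st′

  ↠⇒modalSteps : ∀ m {R : Rel S 0ℓ} {s t t′} → t ↠ t′ → R s t → R s t′ → modalSteps L m R s t t′
  ↠⇒modalSteps o tt′ _  _   = tt′
  ↠⇒modalSteps b tt′ st st′ = tt′ , st , st′

  modalSteps-◅◅ : ∀ m {R : Rel S 0ℓ} {s t t₀ t′} → t ↠ t₀ → R s t →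
                  modalSteps L m R s t₀ t′ → modalSteps L m R s t t′
  modalSteps-◅◅ o tt₀ _  t₀t′           = tt₀ ◅◅ t₀t′
  modalSteps-◅◅ b tt₀ st (t₀t′ , _ , st′) = tt₀ ◅◅ t₀t′ , st , st′

  module _ {x y : Mode} {R : Rel S 0ℓ} (bisim : IsGenericBisim L x y R) where

    private
      answer = proj₂ bisim

    ↠-simulate : ∀ {s t s′} → R s t → s ↠ s′ → ∃[ t′ ] (t ↠ t′ × R s′ t′)
    ↠-simulate st ε = _ , ε , st
    ↠-simulate st (s⇢ ◅ ss′) with answer st s⇢
    ... | inj₁ (_ , s₁t) = ↠-simulate s₁t ss′
    ... | inj₂ (t₁ , t₂ , t′ , tt₁ , t₁⇢t₂ , t₂t′ , s₁t′) with ↠-simulate s₁t′ ss′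
    ...   | t″ , t′t″ , s′t″ =
      t″ , modalSteps⇒↠ x tt₁ ◅◅ (t₁⇢t₂ ◅ (modalSteps⇒↠ y t₂t′ ◅◅ t′t″)) , s′t″

  Bracketed : Rel S 0ℓ → Rel S 0ℓ
  Bracketed R p q = p ↠ q × ∃[ w ] (q ↠ w × R p w)

  bracketed-↠ : ∀ {x y} {R : Rel S 0ℓ} → IsGenericBisim L x y R →
                ∀ {s u p q} → R s u → s ↠ p → p ↠ q → q ↠ u → Bracketed R p q
  bracketed-↠ bisim su sp pq qu with ↠-simulate bisim su sp
  ... | w , uw , pw = pq , w , qu ◅◅ uw , pw

  data StutterClosure (R : Rel S 0ℓ) : Rel S 0ℓ where
    base : ∀ {s t} → R s t → StutterClosure R s t
    same : ∀ {s} → StutterClosure R s s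
    fwd  : ∀ {s t} → Bracketed R s t → StutterClosure R s t
    bwd  : ∀ {s t} → Bracketed R t s → StutterClosure R s t

  StutterClosure-sym : ∀ {R} → (∀ {s t} → R s t → R t s) →
                       ∀ {s t} → StutterClosure R s t → StutterClosure R t s
  StutterClosure-sym R-sym (base st) = base (R-sym st)
  StutterClosure-sym R-sym same      = same
  StutterClosure-sym R-sym (fwd st)  = bwd st
  StutterClosure-sym R-sym (bwd ts)  = fwd ts

  module _ {x y : Mode} {R : Rel S 0ℓ} (bisim : IsGenericBisim L x y R) where

    private
      R⁺ = StutterClosure R
      answer = proj₂ bisim

      Match : S → S → A → S → Set
      Match s t a s′ = ∃[ t₁ ] ∃[ t₂ ] ∃[ t′ ]
        (modalSteps L x R⁺ s t t₁ × t₁ ⟶[ a ] t₂ × modalSteps L y R⁺ s′ t₂ t′ × R⁺ s′ t′)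

      -- t first catches up with s, then copies the move.
      catchUp : ∀ {s t s′ a} → t ↠ s → R⁺ s t → s ⟶[ a ] s′ → Match s t a s′
      catchUp ts st s⟶s′ =
        _ , _ , _ , ↠⇒modalSteps x ts st same , s⟶s′ , ↠⇒modalSteps y ε same same , same

      liftAnswer : ∀ {s t s′ a} → R s t → s ⟶[ a ] s′ → (a ≡ τ × R⁺ s′ t) ⊎ Match s t a s′
      liftAnswer st s⟶s′ with answer st s⟶s′
      ... | inj₁ (a≡τ , s′t) = inj₁ (a≡τ , base s′t)
      ... | inj₂ (t₁ , t₂ , t′ , tt₁ , t₁⟶t₂ , t₂t′ , s′t′) =
        inj₂ (t₁ , t₂ , t′ , modalSteps-map x base tt₁ , t₁⟶t₂ , modalSteps-map y base t₂t′ , base s′t′)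

      -- s ⇢ s′ with s′ R w: if t = w nothing moves, otherwise t matches by
      -- the last τ-step of t ↠ w, every state before it still being bracketed.
      absorbτ : ∀ {s t w s′} → s ↠ t → t ↠ w → R s w → R s′ w → (τ ≡ τ × R⁺ s′ t) ⊎ Match s t τ s′
      absorbτ st ε sw s′w = inj₁ (refl , base s′w)
      absorbτ st (t⇢ ◅ t′w) sw s′w with ◅-unsnoc t⇢ t′w
      ... | w₀ , tw₀ , w₀⇢w =
        inj₂ (w₀ , _ , _
             , ↠⇒modalSteps x tw₀ (fwd (st , _ , t⇢ ◅ t′w , sw)) (fwd (st ◅◅ tw₀ , _ , w₀⇢w ◅ ε , sw))
             , w₀⇢w , ↠⇒modalSteps y ε (base s′w) (base s′w) , base s′w)

      answerBracketed : ∀ {s t s′ a} → Bracketed R s t → s ⟶[ a ] s′ → (a ≡ τ × R⁺ s′ t) ⊎ Match s t a s′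
      answerBracketed st@(s↠t , w , t↠w , sw) s⟶s′ with answer sw s⟶s′
      ... | inj₁ (refl , s′w) = absorbτ s↠t t↠w sw s′w
      ... | inj₂ (t₁ , t₂ , t′ , wt₁ , t₁⟶t₂ , t₂t′ , s′t′) =
        inj₂ (t₁ , t₂ , t′ , modalSteps-◅◅ x t↠w (fwd st) (modalSteps-map x base wt₁)
             , t₁⟶t₂ , modalSteps-map y base t₂t′ , base s′t′)

    StutterClosure-isGenericBisim : IsGenericBisim L x y (StutterClosure R)
    StutterClosure-isGenericBisim = StutterClosure-sym (proj₁ bisim) , answer⁺
      where
      answer⁺ : ∀ {s t s′ a} → R⁺ s t → s ⟶[ a ] s′ → (a ≡ τ × R⁺ s′ t) ⊎ Match s t a s′
      answer⁺ (base st) s⟶s′ = liftAnswer st s⟶s′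
      answer⁺ same      s⟶s′ = inj₂ (catchUp ε same s⟶s′)
      answer⁺ (fwd st)  s⟶s′ = answerBracketed st s⟶s′
      answer⁺ (bwd ts)  s⟶s′ = inj₂ (catchUp (proj₁ ts) (bwd ts) s⟶s′)

  StutterClosure-explicitDivergence : ∀ {R} → ExplicitDivergence L R →
                                      ExplicitDivergence L (StutterClosure R)
  StutterClosure-explicitDivergence div (base st) σ σ₀ σ⇢ with div st σ σ₀ σ⇢
  ... | t′ , tt′ , k , σₖt′ = t′ , tt′ , k , base σₖt′
  StutterClosure-explicitDivergence div same σ refl σ⇢ = σ 1 , [ σ⇢ 0 ] , 1 , same
  StutterClosure-explicitDivergence div (fwd (_ , w , tw , sw)) σ σ₀ σ⇢ with div sw σ σ₀ σ⇢
  ... | w′ , ww′ , k , σₖw′ = w′ , ◅◅⁺ tw ww′ , k , base σₖw′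
  StutterClosure-explicitDivergence div (bwd (ε , _)) σ refl σ⇢ = σ 1 , [ σ⇢ 0 ] , 1 , same
  StutterClosure-explicitDivergence div (bwd (t⇢ ◅ t′s , _)) σ refl σ⇢ = _ , ◅⁺ t⇢ t′s , 0 , same

lemma6p3 : (L : LTS) (x y : Mode) (k : ℕ) (t : Fin (suc k) → LTS.S L) →
    (∀ (i : Fin k) → τStep L (t (inject₁ i)) (t (fsuc i))) →
    BisimED L x y (t fzero) (t (fromℕ k)) →
    ∀ (i j : Fin (suc k)) → BisimED L x y (t i) (t j)
lemma6p3 L x y k t steps (R , (bisim , div) , t₀Rtₖ) i j =
  StutterClosure L R ,
  (StutterClosure-isGenericBisim L bisim , StutterClosure-explicitDivergence L div) ,
  related (≤-total i j)
  where
  path : ∀ {i j} → i ≤ j → Star (τStep L) (t i) (t j)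
  path = chain⇒Star t steps

  bracketed : ∀ {i j} → i ≤ j → Bracketed L R (t i) (t j)
  bracketed {i} {j} i≤j = bracketed-↠ L bisim t₀Rtₖ (path {fzero} {i} z≤n) (path i≤j) (path (≤fromℕ j))

  related : i ≤ j ⊎ j ≤ i → StutterClosure L R (t i) (t j)
  related (inj₁ i≤j) = fwd (bracketed i≤j)
  related (inj₂ j≤i) = bwd (bracketed j≤i)
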